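{- Let $I_3$ be an instance of the setup class model, $\varepsilon\in(0,1/2]$ with $1/\varepsilon\in\mathbb{Z}$ and $T>0$, in which every job has processing time $p'_j\ge\varepsilon^4T$ and every class has setup time $s'_k\ge\varepsilon^3T$. Let $I_4$ be the instance obtained by replacing each processing time $p'_j$ by $\bar p_j=\lceil\tilde p_j/(\varepsilon^5T)\rceil\varepsilon^5T$ where $\tilde p_j=(1+\varepsilon)^{\lceil\log_{1+\varepsilon}(p'_j/(\varepsilon^4T))\rceil}\varepsilon^4T$, and each setup time $s'_k$ by $\bar s_k=\lceil\tilde s_k/(\varepsilon^5T)\rceil\varepsilon^5T$ where $\tilde s_k=(1+\varepsilon)^{\lceil\log_{1+\varepsilon}(s'_k/(\varepsilon^3T))\rceil}\varepsilon^3T$. Then for all $T',L'$, a $(T',L')$-schedule for $I_3$ induces a $((1+3\varepsilon)T',L')$-schedule for $I_4$, and any $(T',L')$-schedule for $I_4$ can be turned into a $(T',L')$-schedule for $I_3$.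
   Context: Setup class model: jobs $\mathcal{J}$, $m$ identical machines, classes; job $j$ has processing time and class $k_j$; class $k$ has a setup time. A schedule is an assignment $\sigma:\mathcal{J}\to[m]$; the load of machine $i$ is the sum of processing times of the jobs assigned to it plus the setup times of the distinct classes of these jobs; the makespan is the maximum load. A $(T',L')$-schedule is a schedule with makespan at most $T'$ and free space $\sum_i(T'-\text{load}_i)\ge L'$.
   Formalization: The processing times $p'_j$, the setup times $s'_k$, the bound T and the values T′ and L′ are all rational. -}

module Defs where

open import Data.Nat using (ℕ; zero; suc)
open import Data.Fin using (Fin)
open import Data.Fin.Properties using (any?)
open import Data.Integer using (ℤ)
open import Data.Product using (∃; _×_; _,_)
open import Data.Bool using (if_then_else_)
open import Relation.Nullary.Decidable using (⌊_⌋; _×-dec_)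
open import Relation.Binary.PropositionalEquality using (_≡_)
open import Data.Rational using (ℚ; 0ℚ; 1ℚ; _+_; _*_; _-_; _÷_; _≤_; _<_; _/_; NonZero; Positive; positive)
open import Data.Rational.Properties using (pos*pos⇒pos; pos⇒nonZero)
import Data.Fin as F

_^_ : ℚ → ℕ → ℚ
x ^ zero  = 1ℚ
x ^ suc n = x * (x ^ n)

infixr 8 _^_

ℤ→ℚ : ℤ → ℚ
ℤ→ℚ z = z / 1

sumFin : (n : ℕ) → (Fin n → ℚ) → ℚ
sumFin zero    f = 0ℚ
sumFin (suc n) f = f F.zero + sumFin n (λ i → f (F.suc i))

-- Jobs are Fin n, classes are Fin K, machines are Fin m.
-- cls j is the class k_j of job j; p j its processing time; s k the
-- setup time of class k.  A schedule is σ : Fin n → Fin m.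

load : {n K m : ℕ} → (Fin n → Fin K) → (Fin n → ℚ) → (Fin K → ℚ) →
       (Fin n → Fin m) → Fin m → ℚ
load {n} {K} cls p s σ i =
  sumFin n (λ j → if ⌊ σ j F.≟ i ⌋ then p j else 0ℚ)
  + sumFin K (λ k → if ⌊ any? (λ j → (σ j F.≟ i) ×-dec (cls j F.≟ k)) ⌋
                    then s k else 0ℚ)

IsSchedule : {n K m : ℕ} → (Fin n → Fin K) → (Fin n → ℚ) → (Fin K → ℚ) →
             (T' L' : ℚ) → (Fin n → Fin m) → Set
IsSchedule {m = m} cls p s T' L' σ =
  (∀ i → load cls p s σ i ≤ T')
  × (L' ≤ sumFin m (λ i → T' - load cls p s σ i))

-- (1+ε)^⌈log_{1+ε}(x/base)⌉ · base, for x ≥ base > 0, written out: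
-- the value (1+ε)^e · base where e is the least natural number with
-- (1+ε)^e · base ≥ x  (e = ⌈log_{1+ε}(x/base)⌉ ≥ 0 since x/base ≥ 1).
IsGeomRound : (ε base x y : ℚ) → Set
IsGeomRound ε base x y =
  ∃ λ (e : ℕ) → (y ≡ (1ℚ + ε) ^ e * base)
              × (x ≤ (1ℚ + ε) ^ e * base)
              × (∀ (e' : ℕ) → Data.Nat._<_ e' e → (1ℚ + ε) ^ e' * base < x)
  where import Data.Nat

powPos : (ε : ℚ) → 0ℚ < ε → (k : ℕ) → Positive (ε ^ k)
powPos ε h zero    = positive (Data.Rational.Properties.positive⁻¹ 1ℚ)
  where import Data.Rational.Properties
powPos ε h (suc k) = pos*pos⇒pos ε {{positive h}} (ε ^ k) {{powPos ε h k}}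

unitNonZero : (ε T : ℚ) → 0ℚ < ε → 0ℚ < T → NonZero (ε ^ 5 * T)
unitNonZero ε T hε hT =
  pos⇒nonZero (ε ^ 5 * T)
    {{pos*pos⇒pos (ε ^ 5) {{powPos ε hε 5}} T {{positive hT}}}}

ceilToGrid : (ε T : ℚ) → 0ℚ < ε → 0ℚ < T → ℚ → ℚ
ceilToGrid ε T hε hT x =
  ℤ→ℚ (Data.Rational.ceiling ((x ÷ (ε ^ 5 * T)) {{unitNonZero ε T hε hT}}))
    * (ε ^ 5 * T)
  where import Data.Rational

-- Each rounding can only increase a time, and by a factor of at most 1 + 2ε: the geometric
-- rounding costs a factor 1 + ε, and the grid step ε⁵T adds at most ε times the time, since
-- every time is at least ε⁴T.  Loads are nonnegative combinations of times, so a schedule for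
-- I₃ stays a schedule for I₄ with every load ℓ inflated to at most (1 + 2ε)ℓ ≤ (1 + 3ε)T', and
-- its free space does not shrink because (1 + 3ε)T' − (1 + 2ε)ℓ ≥ T' − ℓ for 0 ≤ ℓ ≤ T'.
-- Conversely, a schedule for I₄ is, unchanged, a schedule for I₃.
module Submission where

open import Defs
open import Data.Bool using (Bool; true; false; if_then_else_)
open import Data.Fin as Fin using (Fin)
open import Data.Fin.Properties using (any?)
open import Data.Integer as ℤ using (ℤ; +_; -[1+_]; 1ℤ)
import Data.Integer.DivMod as ℤ
import Data.Integer.Properties as ℤ
open import Data.Nat using (ℕ; zero; suc)
import Data.Nat.Coprimality as Coprimality
open import Data.Nat.Properties using (n<1+n)
open import Data.Product using (∃; _×_; _,_; proj₁; proj₂)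
open import Data.Rational as ℚ
  using (ℚ; mkℚ; 0ℚ; 1ℚ; ½; _+_; _*_; _-_; -_; _÷_; _≤_; _<_; _/_; *≤*; *<*;
         NonZero; nonNegative; positive)
import Data.Rational.Properties as ℚ
open import Data.Rational.Solver using (module +-*-Solver)
open import Function using (_∘_)
open import Relation.Binary.PropositionalEquality
open import Relation.Nullary.Decidable using (⌊_⌋; _×-dec_)

open +-*-Solver

ℤ→ℚ≡mkℚ : ∀ z → ℤ→ℚ z ≡ mkℚ z 0 (Coprimality.sym (Coprimality.1-coprimeTo ℤ.∣ z ∣))
ℤ→ℚ≡mkℚ (+ n)    = ℚ.normalize-coprime (Coprimality.sym (Coprimality.1-coprimeTo n))
ℤ→ℚ≡mkℚ -[1+ n ] = cong -_ (ℚ.normalize-coprime (Coprimality.sym (Coprimality.1-coprimeTo (suc n))))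

ℤ→ℚ-neg : ∀ z → ℤ→ℚ (ℤ.- z) ≡ - ℤ→ℚ z
ℤ→ℚ-neg z rewrite ℤ→ℚ≡mkℚ (ℤ.- z) | ℤ→ℚ≡mkℚ z with z
... | + zero   = refl
... | + suc _  = refl
... | -[1+ _ ] = refl

ℤ→ℚ-suc : ∀ z → ℤ→ℚ (ℤ.suc z) ≡ ℤ→ℚ z + 1ℚ
ℤ→ℚ-suc z rewrite ℤ→ℚ≡mkℚ z =
  cong ℤ→ℚ (trans (ℤ.+-comm 1ℤ z) (cong (ℤ._+ 1ℤ) (sym (ℤ.*-identityʳ z))))

⌊p⌋≤p : ∀ p → ℤ→ℚ (ℚ.floor p) ≤ p
⌊p⌋≤p p@(mkℚ n d _) rewrite ℤ→ℚ≡mkℚ (ℚ.floor p) =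
  *≤* (subst (ℚ.floor p ℤ.* + suc d ℤ.≤_) (sym (ℤ.*-identityʳ n)) (ℤ.[n/d]*d≤n n (+ suc d)))

p<⌊p⌋+1 : ∀ p → p < ℤ→ℚ (ℚ.floor p) + 1ℚ
p<⌊p⌋+1 p@(mkℚ n d _) rewrite sym (ℤ→ℚ-suc (ℚ.floor p)) | ℤ→ℚ≡mkℚ (ℤ.suc (ℚ.floor p)) =
  *<* (subst₂ ℤ._<_ (sym (ℤ.*-identityʳ n))
                    (cong (λ f → ℤ.suc f ℤ.* + suc d) (sym (ℤ.div-pos-is-/ℕ n (suc d))))
                    (ℤ.n<s[n/ℕd]*d n (suc d)))

p≤⌈p⌉ : ∀ p → p ≤ ℤ→ℚ (ℚ.ceiling p)
p≤⌈p⌉ p@record{} =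
  subst₂ _≤_ (solve 1 (λ p → :- (:- p) := p) refl p) (sym (ℤ→ℚ-neg (ℚ.floor (- p))))
         (ℚ.neg-antimono-≤ (⌊p⌋≤p (- p)))

⌈p⌉<p+1 : ∀ p → ℤ→ℚ (ℚ.ceiling p) < p + 1ℚ
⌈p⌉<p+1 p@record{} = subst₂ _<_ ⌈p⌉≡ (solve 1 (λ p → :- (:- p) :+ con 1ℚ := p :+ con 1ℚ) refl p)
  (ℚ.+-monoˡ-< 1ℚ (ℚ.neg-antimono-< (subst (- p <_) (sym (ℤ→ℚ-suc f)) (p<⌊p⌋+1 (- p)))))
  where
  f : ℤ
  f = ℚ.floor (- p)
  ⌈p⌉≡ : - ℤ→ℚ (ℤ.suc f) + 1ℚ ≡ ℤ→ℚ (ℤ.- f)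
  ⌈p⌉≡ = begin
    - ℤ→ℚ (ℤ.suc f) + 1ℚ         ≡⟨ cong (_+ 1ℚ) (ℤ→ℚ-neg (ℤ.suc f)) ⟨
    ℤ→ℚ (ℤ.- ℤ.suc f) + 1ℚ       ≡⟨ ℤ→ℚ-suc (ℤ.- ℤ.suc f) ⟨
    ℤ→ℚ (ℤ.suc (ℤ.- ℤ.suc f))    ≡⟨ cong (ℤ→ℚ ∘ ℤ.suc) (ℤ.neg-distrib-+ 1ℤ f) ⟩
    ℤ→ℚ (ℤ.suc (ℤ.pred (ℤ.- f))) ≡⟨ cong ℤ→ℚ (ℤ.suc-pred (ℤ.- f)) ⟩
    ℤ→ℚ (ℤ.- f)                  ∎
    where open ≡-Reasoning

≤-by-gap : ∀ {p q} d → 0ℚ ≤ d → p + d ≡ q → p ≤ q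
≤-by-gap {p} d 0≤d refl = subst (_≤ p + d) (ℚ.+-identityʳ p) (ℚ.+-monoʳ-≤ p 0≤d)

0≤q-p⇒p≤q : ∀ {p q} → 0ℚ ≤ q - p → p ≤ q
0≤q-p⇒p≤q {p} {q} 0≤q-p = ≤-by-gap (q - p) 0≤q-p (solve 2 (λ p q → p :+ (q :- p) := q) refl p q)

p≤q⇒0≤q-p : ∀ {p q} → p ≤ q → 0ℚ ≤ q - p
p≤q⇒0≤q-p {p} {q} p≤q = subst (_≤ q - p) (ℚ.+-inverseʳ p) (ℚ.+-monoˡ-≤ (- p) p≤q)

0≤+ : ∀ {p q} → 0ℚ ≤ p → 0ℚ ≤ q → 0ℚ ≤ p + q
0≤+ {p} {q} 0≤p 0≤q = ℚ.nonNegative⁻¹ _ {{ℚ.nonNeg+nonNeg⇒nonNeg p {{nonNegative 0≤p}} q {{nonNegative 0≤q}}}}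

0≤* : ∀ {p q} → 0ℚ ≤ p → 0ℚ ≤ q → 0ℚ ≤ p * q
0≤* {p} {q} 0≤p 0≤q = ℚ.nonNegative⁻¹ _ {{ℚ.nonNeg*nonNeg⇒nonNeg p {{nonNegative 0≤p}} q {{nonNegative 0≤q}}}}

*-monoˡ-≤ : ∀ {r p q} → 0ℚ ≤ r → p ≤ q → r * p ≤ r * q
*-monoˡ-≤ {r} 0≤r = ℚ.*-monoˡ-≤-nonNeg r {{nonNegative 0≤r}}

p≤1⇒p*q≤q : ∀ {p q} → p ≤ 1ℚ → 0ℚ ≤ q → p * q ≤ q
p≤1⇒p*q≤q {p} {q} p≤1 0≤q =
  subst (p * q ≤_) (ℚ.*-identityˡ q) (ℚ.*-monoʳ-≤-nonNeg q {{nonNegative 0≤q}} p≤1)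

ceilToMultiple-bounds : ∀ y u .{{_ : NonZero u}} → 0ℚ < u →
                        y ≤ ℤ→ℚ (ℚ.ceiling (y ÷ u)) * u × ℤ→ℚ (ℚ.ceiling (y ÷ u)) * u ≤ y + u
ceilToMultiple-bounds y u 0<u =
  subst (_≤ ℤ→ℚ (ℚ.ceiling (y ÷ u)) * u) y÷u*u≡y (*u-mono (p≤⌈p⌉ (y ÷ u))) ,
  subst (ℤ→ℚ (ℚ.ceiling (y ÷ u)) * u ≤_)
        (trans (ℚ.*-distribʳ-+ u (y ÷ u) 1ℚ) (cong₂ _+_ y÷u*u≡y (ℚ.*-identityˡ u)))
        (*u-mono (ℚ.<⇒≤ (⌈p⌉<p+1 (y ÷ u))))
  where
  *u-mono : ∀ {p q} → p ≤ q → p * u ≤ q * u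
  *u-mono = ℚ.*-monoʳ-≤-nonNeg u {{nonNegative (ℚ.<⇒≤ 0<u)}}
  y÷u*u≡y : y ÷ u * u ≡ y
  y÷u*u≡y = trans (ℚ.*-assoc y (ℚ.1/ u) u) (trans (cong (y *_) (ℚ.*-inverseˡ u)) (ℚ.*-identityʳ y))

IsGeomRound-bounds : ∀ {ε base x y} → 0ℚ ≤ ε → 0ℚ ≤ base → base ≤ x →
                     IsGeomRound ε base x y → x ≤ y × y ≤ (1ℚ + ε) * x
IsGeomRound-bounds {ε} {base} {x} 0≤ε 0≤base base≤x (zero , refl , x≤y , _) = x≤y , (begin
  1ℚ * base     ≡⟨ ℚ.*-identityˡ base ⟩
  base          ≤⟨ base≤x ⟩
  x             ≤⟨ ≤-by-gap (ε * x) (0≤* 0≤ε (ℚ.≤-trans 0≤base base≤x))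
                            (solve 2 (λ ε x → x :+ ε :* x := (con 1ℚ :+ ε) :* x) refl ε x) ⟩
  (1ℚ + ε) * x  ∎)
  where open ℚ.≤-Reasoning
IsGeomRound-bounds {ε} {base} {x} 0≤ε _ _ (suc e , refl , x≤y , below) = x≤y , (begin
  (1ℚ + ε) ^ suc e * base           ≡⟨ ℚ.*-assoc (1ℚ + ε) ((1ℚ + ε) ^ e) base ⟩
  (1ℚ + ε) * ((1ℚ + ε) ^ e * base)  ≤⟨ *-monoˡ-≤ (0≤+ (ℚ.nonNegative⁻¹ 1ℚ) 0≤ε) (ℚ.<⇒≤ (below e (n<1+n e))) ⟩
  (1ℚ + ε) * x                      ∎)
  where open ℚ.≤-Reasoning

module _ {ε T : ℚ} (0<ε : 0ℚ < ε) (0<T : 0ℚ < T) where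

  ε^k*T-pos : ∀ k → 0ℚ < ε ^ k * T
  ε^k*T-pos k = ℚ.positive⁻¹ _ {{ℚ.pos*pos⇒pos (ε ^ k) {{powPos ε 0<ε k}} T {{positive 0<T}}}}

  rounding-bounds : ∀ {base x x̄} → 0ℚ ≤ base → base ≤ x → ε ^ 5 * T ≤ ε * base →
                    (∃ λ x̃ → IsGeomRound ε base x x̃ × x̄ ≡ ceilToGrid ε T 0<ε 0<T x̃) →
                    x ≤ x̄ × x̄ ≤ (1ℚ + (+ 2 / 1) * ε) * x
  rounding-bounds {base} {x} 0≤base base≤x u≤ε*base (x̃ , geom , refl) =
    ℚ.≤-trans (proj₁ geomBounds) (proj₁ gridBounds) , (begin
      ceilToGrid ε T 0<ε 0<T x̃  ≤⟨ proj₂ gridBounds ⟩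
      x̃ + u                     ≤⟨ ℚ.+-mono-≤ (proj₂ geomBounds) (ℚ.≤-trans u≤ε*base (*-monoˡ-≤ 0≤ε base≤x)) ⟩
      (1ℚ + ε) * x + ε * x      ≡⟨ solve 2 (λ ε x → (con 1ℚ :+ ε) :* x :+ ε :* x
                                                  := (con 1ℚ :+ con (+ 2 / 1) :* ε) :* x) refl ε x ⟩
      (1ℚ + (+ 2 / 1) * ε) * x  ∎)
    where
    open ℚ.≤-Reasoning
    u : ℚ
    u = ε ^ 5 * T
    instance
      u≢0 : NonZero u
      u≢0 = unitNonZero ε T 0<ε 0<T
    0≤ε : 0ℚ ≤ ε
    0≤ε = ℚ.<⇒≤ 0<ε
    geomBounds : x ≤ x̃ × x̃ ≤ (1ℚ + ε) * x
    geomBounds = IsGeomRound-bounds 0≤ε 0≤base base≤x geom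
    gridBounds : x̃ ≤ ceilToGrid ε T 0<ε 0<T x̃ × ceilToGrid ε T 0<ε 0<T x̃ ≤ x̃ + u
    gridBounds = ceilToMultiple-bounds x̃ u (ε^k*T-pos 5)

sumFin-mono-≤ : ∀ n {f g : Fin n → ℚ} → (∀ j → f j ≤ g j) → sumFin n f ≤ sumFin n g
sumFin-mono-≤ zero    f≤g = ℚ.≤-refl
sumFin-mono-≤ (suc n) f≤g = ℚ.+-mono-≤ (f≤g Fin.zero) (sumFin-mono-≤ n (λ j → f≤g (Fin.suc j)))

sumFin-nonNeg : ∀ n {f : Fin n → ℚ} → (∀ j → 0ℚ ≤ f j) → 0ℚ ≤ sumFin n f
sumFin-nonNeg zero    0≤f = ℚ.≤-refl
sumFin-nonNeg (suc n) 0≤f = 0≤+ (0≤f Fin.zero) (sumFin-nonNeg n (λ j → 0≤f (Fin.suc j)))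

sumFin-cong : ∀ n {f g : Fin n → ℚ} → (∀ j → f j ≡ g j) → sumFin n f ≡ sumFin n g
sumFin-cong zero    f≡g = refl
sumFin-cong (suc n) f≡g = cong₂ _+_ (f≡g Fin.zero) (sumFin-cong n (λ j → f≡g (Fin.suc j)))

sumFin-*ˡ : ∀ n c (f : Fin n → ℚ) → sumFin n (λ j → c * f j) ≡ c * sumFin n f
sumFin-*ˡ zero    c f = sym (ℚ.*-zeroʳ c)
sumFin-*ˡ (suc n) c f = trans (cong (λ rest → c * f Fin.zero + rest) (sumFin-*ˡ n c (λ j → f (Fin.suc j))))
                              (sym (ℚ.*-distribˡ-+ c _ _))

if-mono-≤ : ∀ b {p q} → p ≤ q → (if b then p else 0ℚ) ≤ (if b then q else 0ℚ)
if-mono-≤ true  p≤q = p≤q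
if-mono-≤ false _   = ℚ.≤-refl

if-nonNeg : ∀ b {p} → 0ℚ ≤ p → 0ℚ ≤ (if b then p else 0ℚ)
if-nonNeg true  0≤p = 0≤p
if-nonNeg false _   = ℚ.≤-refl

if-*ˡ : ∀ b c p → (if b then c * p else 0ℚ) ≡ c * (if b then p else 0ℚ)
if-*ˡ true  c p = refl
if-*ˡ false c p = sym (ℚ.*-zeroʳ c)

module _ {n K m : ℕ} (cls : Fin n → Fin K) (σ : Fin n → Fin m) (i : Fin m) where

  private
    onMachine : Fin n → Bool
    onMachine j = ⌊ σ j Fin.≟ i ⌋

    classOnMachine : Fin K → Bool
    classOnMachine k = ⌊ any? (λ j → (σ j Fin.≟ i) ×-dec (cls j Fin.≟ k)) ⌋

  load-mono-≤ : ∀ {p q : Fin n → ℚ} {s t : Fin K → ℚ} → (∀ j → p j ≤ q j) → (∀ k → s k ≤ t k) →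
                load cls p s σ i ≤ load cls q t σ i
  load-mono-≤ p≤q s≤t = ℚ.+-mono-≤ (sumFin-mono-≤ n (λ j → if-mono-≤ (onMachine j) (p≤q j)))
                                   (sumFin-mono-≤ K (λ k → if-mono-≤ (classOnMachine k) (s≤t k)))

  load-nonNeg : ∀ {p : Fin n → ℚ} {s : Fin K → ℚ} → (∀ j → 0ℚ ≤ p j) → (∀ k → 0ℚ ≤ s k) →
                0ℚ ≤ load cls p s σ i
  load-nonNeg 0≤p 0≤s = 0≤+ (sumFin-nonNeg n (λ j → if-nonNeg (onMachine j) (0≤p j)))
                            (sumFin-nonNeg K (λ k → if-nonNeg (classOnMachine k) (0≤s k)))

  load-*ˡ : ∀ c (p : Fin n → ℚ) (s : Fin K → ℚ) →
            load cls (λ j → c * p j) (λ k → c * s k) σ i ≡ c * load cls p s σ i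
  load-*ˡ c p s = begin
    load cls (λ j → c * p j) (λ k → c * s k) σ i
      ≡⟨ cong₂ _+_ (sumFin-cong n (λ j → if-*ˡ (onMachine j) c (p j)))
                   (sumFin-cong K (λ k → if-*ˡ (classOnMachine k) c (s k))) ⟩
    sumFin n (λ j → c * jobTime j) + sumFin K (λ k → c * setupTime k)
      ≡⟨ cong₂ _+_ (sumFin-*ˡ n c jobTime) (sumFin-*ˡ K c setupTime) ⟩
    c * sumFin n jobTime + c * sumFin K setupTime
      ≡⟨ ℚ.*-distribˡ-+ c _ _ ⟨
    c * load cls p s σ i ∎
    where
    open ≡-Reasoning
    jobTime : Fin n → ℚ
    jobTime j = if onMachine j then p j else 0ℚ
    setupTime : Fin K → ℚ
    setupTime k = if classOnMachine k then s k else 0ℚ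

inflation-slack : ∀ {ε T' l} → 0ℚ ≤ ε → 0ℚ ≤ l → l ≤ T' →
                  T' - l ≤ (1ℚ + (+ 3 / 1) * ε) * T' - (1ℚ + (+ 2 / 1) * ε) * l
inflation-slack {ε} {T'} {l} 0≤ε 0≤l l≤T' =
  ≤-by-gap (ε * ((+ 3 / 1) * (T' - l) + l))
    (0≤* 0≤ε (0≤+ (0≤* (ℚ.nonNegative⁻¹ (+ 3 / 1)) (p≤q⇒0≤q-p l≤T')) 0≤l))
    (solve 3 (λ ε T' l → (T' :- l) :+ ε :* (con (+ 3 / 1) :* (T' :- l) :+ l)
                        := (con 1ℚ :+ con (+ 3 / 1) :* ε) :* T' :- (con 1ℚ :+ con (+ 2 / 1) :* ε) :* l)
             refl ε T' l)

module _ {n K m : ℕ} {cls : Fin n → Fin K} {T' L' : ℚ} {σ : Fin n → Fin m} where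

  IsSchedule-antimono : ∀ {p q : Fin n → ℚ} {s t : Fin K → ℚ} → (∀ j → p j ≤ q j) → (∀ k → s k ≤ t k) →
                        IsSchedule cls q t T' L' σ → IsSchedule cls p s T' L' σ
  IsSchedule-antimono {p} {q} {s} {t} p≤q s≤t (fits , free) =
    (λ i → ℚ.≤-trans (lighter i) (fits i)) ,
    ℚ.≤-trans free (sumFin-mono-≤ m (λ i → ℚ.+-monoʳ-≤ T' (ℚ.neg-antimono-≤ (lighter i))))
    where
    lighter : ∀ i → load cls p s σ i ≤ load cls q t σ i
    lighter i = load-mono-≤ cls σ i p≤q s≤t

  IsSchedule-inflate : ∀ {ε} {p q : Fin n → ℚ} {s t : Fin K → ℚ} →
                       0ℚ ≤ ε → (∀ j → 0ℚ ≤ p j) → (∀ k → 0ℚ ≤ s k) →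
                       (∀ j → q j ≤ (1ℚ + (+ 2 / 1) * ε) * p j) → (∀ k → t k ≤ (1ℚ + (+ 2 / 1) * ε) * s k) →
                       IsSchedule cls p s T' L' σ → IsSchedule cls q t ((1ℚ + (+ 3 / 1) * ε) * T') L' σ
  IsSchedule-inflate {ε} {p} {q} {s} {t} 0≤ε 0≤p 0≤s q≤ t≤ (fits , free) =
    (λ i → 0≤q-p⇒p≤q (ℚ.≤-trans (p≤q⇒0≤q-p (fits i)) (slack i))) ,
    ℚ.≤-trans free (sumFin-mono-≤ m slack)
    where
    inflated-load : ∀ i → load cls q t σ i ≤ (1ℚ + (+ 2 / 1) * ε) * load cls p s σ i
    inflated-load i = ℚ.≤-trans (load-mono-≤ cls σ i q≤ t≤)
                                (ℚ.≤-reflexive (load-*ˡ cls σ i (1ℚ + (+ 2 / 1) * ε) p s))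
    slack : ∀ i → T' - load cls p s σ i ≤ (1ℚ + (+ 3 / 1) * ε) * T' - load cls q t σ i
    slack i = ℚ.≤-trans (inflation-slack 0≤ε (load-nonNeg cls σ i 0≤p 0≤s) (fits i))
                (ℚ.+-monoʳ-≤ ((1ℚ + (+ 3 / 1) * ε) * T') (ℚ.neg-antimono-≤ (inflated-load i)))

lemma8 : (m n K : ℕ) (cls : Fin n → Fin K) (p' : Fin n → ℚ) (s' : Fin K → ℚ)
         (ε T : ℚ) (hε : 0ℚ < ε) → ε ≤ ½ → (∃ λ (z : ℤ) → ε * ℤ→ℚ z ≡ 1ℚ) →
         (hT : 0ℚ < T) →
         (∀ j → ε ^ 4 * T ≤ p' j) → (∀ k → ε ^ 3 * T ≤ s' k) →
         (p̄ : Fin n → ℚ) (s̄ : Fin K → ℚ) →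
         (∀ j → ∃ λ p̃ → IsGeomRound ε (ε ^ 4 * T) (p' j) p̃
                        × p̄ j ≡ ceilToGrid ε T hε hT p̃) →
         (∀ k → ∃ λ s̃ → IsGeomRound ε (ε ^ 3 * T) (s' k) s̃
                        × s̄ k ≡ ceilToGrid ε T hε hT s̃) →
         (T' L' : ℚ) →
         ((σ : Fin n → Fin m) → IsSchedule cls p' s' T' L' σ →
            IsSchedule cls p̄ s̄ ((1ℚ + (+ 3 / 1) * ε) * T') L' σ)
         × ((σ : Fin n → Fin m) → IsSchedule cls p̄ s̄ T' L' σ →
            ∃ λ (σ' : Fin n → Fin m) → IsSchedule cls p' s' T' L' σ')
lemma8 m n K cls p' s' ε T 0<ε ε≤½ _ 0<T ε⁴T≤p' ε³T≤s' p̄ s̄ p̄-rounds s̄-rounds T' L' =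
  (λ σ → IsSchedule-inflate 0≤ε 0≤p' 0≤s' (proj₂ ∘ p̄-bounds) (proj₂ ∘ s̄-bounds)) ,
  (λ σ schedule → σ , IsSchedule-antimono (proj₁ ∘ p̄-bounds) (proj₁ ∘ s̄-bounds) schedule)
  where
  0≤ε : 0ℚ ≤ ε
  0≤ε = ℚ.<⇒≤ 0<ε

  ε≤1 : ε ≤ 1ℚ
  ε≤1 = ℚ.≤-trans ε≤½ (ℚ.≤ᵇ⇒≤ _)

  0≤ε^k*T : ∀ k → 0ℚ ≤ ε ^ k * T
  0≤ε^k*T k = ℚ.<⇒≤ (ε^k*T-pos 0<ε 0<T k)

  0≤p' : ∀ j → 0ℚ ≤ p' j
  0≤p' j = ℚ.≤-trans (0≤ε^k*T 4) (ε⁴T≤p' j)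

  0≤s' : ∀ k → 0ℚ ≤ s' k
  0≤s' k = ℚ.≤-trans (0≤ε^k*T 3) (ε³T≤s' k)

  ε⁵T≤ε*ε³T : ε ^ 5 * T ≤ ε * (ε ^ 3 * T)
  ε⁵T≤ε*ε³T = begin
    ε ^ 5 * T              ≡⟨ ℚ.*-assoc ε (ε ^ 4) T ⟩
    ε * (ε ^ 4 * T)        ≡⟨ cong (ε *_) (ℚ.*-assoc ε (ε ^ 3) T) ⟩
    ε * (ε * (ε ^ 3 * T))  ≤⟨ *-monoˡ-≤ 0≤ε (p≤1⇒p*q≤q ε≤1 (0≤ε^k*T 3)) ⟩
    ε * (ε ^ 3 * T)        ∎
    where open ℚ.≤-Reasoning

  p̄-bounds : ∀ j → p' j ≤ p̄ j × p̄ j ≤ (1ℚ + (+ 2 / 1) * ε) * p' j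
  p̄-bounds j = rounding-bounds 0<ε 0<T (0≤ε^k*T 4) (ε⁴T≤p' j) (ℚ.≤-reflexive (ℚ.*-assoc ε (ε ^ 4) T)) (p̄-rounds j)

  s̄-bounds : ∀ k → s' k ≤ s̄ k × s̄ k ≤ (1ℚ + (+ 2 / 1) * ε) * s' k
  s̄-bounds k = rounding-bounds 0<ε 0<T (0≤ε^k*T 3) (ε³T≤s' k) ε⁵T≤ε*ε³T (s̄-rounds k)
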